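{- Let $H$ be a linear hypergraph, $\mathscr{H}$ a set of subhypergraphs of $H$, and $\mathscr{C}$ a tidy cycle of copies in $\mathscr{H}^+$ such that $\mathrm{Girth}(H,\mathscr{H}^+)>h(\mathscr{C})$. Then all connectors of $\mathscr{C}$ are vertices.
   Context: Hypergraphs are pairs $(V,E)$ with $E$ a set of $k$-subsets of a finite set $V$; linear means two distinct edges share at most one vertex. For $e\in E(H)$, $e^+=(e,\{e\})$, $\mathscr{H}^+=\mathscr{H}\cup\{e^+:e\in E(H)\}$. A cycle of copies is a cyclic sequence $F_1q_1\ldots F_nq_n$, $n\ge2$ (its length), with $F_i\in\mathscr{H}^+$, $F_i\ne F_{i+1}$, connectors $q_i$ distinct elements of $V(H)\cup E(H)$, a vertex $q_i$ in $V(F_i)\cap V(F_{i+1})$, an edge $q_i$ in $E(F_i)\cap E(F_{i+1})$. Index $i$ pure if $q_{i-1},q_i$ are both vertices or both edges, mixed otherwise; order $=$ #pure$+\frac12$#mixed; $h(\mathscr{C})=(\text{order},\text{length})\in\mathbb{N}^2$, pairs compared lexicographically. Tidy: (T1) no connectors $q_i,q_j$ with $q_i\in q_j$; (T2) for every edge $f$, $\{i:q_i$ vertex in $f\}\subseteq\{i_\star,i_\star+1\}$ for some $i_\star$. A master copy is a copy $F_\star$ occurring in the cycle with edges $f_i\in E(F_\star)$ for each $i$ with $F_i\ne F_\star$ such that replacing these $F_i$ by $f_i^+$ yields a cycle of copies. For $(g,n)\in\mathbb{N}^2$, $\mathrm{Girth}(H,\mathscr{H}^+)>(g,n)$ means every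 tidy cycle of copies $\mathscr{D}$ in $\mathscr{H}^+$ with $h(\mathscr{D})\le(g,n)$ has a master copy. -}

module Defs where

open import Data.Nat using (ℕ; zero; suc; _+_; _*_; _≤_; _<_)
open import Data.Nat.DivMod using (_mod_)
open import Data.Fin using (Fin; toℕ)
open import Data.Fin.Subset using (Subset; _∈_; _⊆_; _∩_; ∣_∣)
open import Data.Bool using (Bool; true; false; _∧_)
open import Data.Bool.Properties using () renaming (_≟_ to _≟B_)
open import Data.Vec.Properties using (≡-dec)
open import Data.List using (List; map; allFin)
open import Data.Nat.ListAction using (sum)
open import Data.Product using (Σ; ∃; _×_; _,_)
open import Data.Sum using (_⊎_; inj₁; inj₂)
open import Relation.Nullary using (¬_; Dec; yes; no)
open import Relation.Nullary.Decidable using (⌊_⌋)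
open import Relation.Binary.PropositionalEquality using (_≡_; _≢_)

-- The ambient vertex set of H is Fin n.

_≟S_ : ∀ {n} (a b : Subset n) → Dec (a ≡ b)
_≟S_ = ≡-dec _≟B_

_∈E_ : ∀ {n} → Subset n → (Subset n → Bool) → Set
e ∈E E = E e ≡ true

record Hypergraph (n k : ℕ) : Set where
  field
    E       : Subset n → Bool
    uniform : ∀ e → e ∈E E → ∣ e ∣ ≡ k
open Hypergraph public

Linear : ∀ {n k} → Hypergraph n k → Set
Linear {n} H = ∀ (e f : Subset n) → e ∈E E H → f ∈E E H → e ≢ f → ∣ e ∩ f ∣ ≤ 1

record HG (n : ℕ) : Set where
  constructor hg
  field
    V  : Subset n
    Es : Subset n → Bool
open HG public

IsSub : ∀ {n k} → Hypergraph n k → HG n → Set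
IsSub {n} H F = ∀ (e : Subset n) → e ∈E Es F → (e ∈E E H) × (e ⊆ V F)

_≈H_ : ∀ {n} → HG n → HG n → Set
_≈H_ {n} F G = (V F ≡ V G) × (∀ (e : Subset n) → Es F e ≡ Es G e)

plus : ∀ {n} → Subset n → HG n
plus e = hg e (λ f → ⌊ f ≟S e ⌋)

In⁺ : ∀ {n k} → Hypergraph n k → (HG n → Set) → HG n → Set
In⁺ {n} H ℋ F = ℋ F ⊎ Σ (Subset n) (λ e → (e ∈E E H) × (F ≡ plus e))

-- connectors: vertices (inj₁) or edges (inj₂)
Conn : ℕ → Set
Conn n = Fin n ⊎ Subset n

IsVertex : ∀ {n} → Conn n → Set
IsVertex {n} q = Σ (Fin n) (λ v → q ≡ inj₁ v)

isEdge : ∀ {n} → Conn n → Bool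
isEdge (inj₁ _) = false
isEdge (inj₂ _) = true

next : ∀ {m} → Fin m → Fin m
next {suc m} i = suc (toℕ i) mod suc m

prev : ∀ {m} → Fin m → Fin m
prev {suc m} i = (toℕ i + m) mod suc m

ConnIn : ∀ {n} → Conn n → HG n → Set
ConnIn (inj₁ v) F = v ∈ V F
ConnIn (inj₂ f) F = f ∈E Es F

record IsCycle {n k : ℕ} (H : Hypergraph n k) (ℋ : HG n → Set)
               (m : ℕ) (F : Fin m → HG n) (q : Fin m → Conn n) : Set where
  field
    len≥2    : 2 ≤ m
    inH⁺     : ∀ i → In⁺ H ℋ (F i)
    distinct : ∀ i → ¬ (F i ≈H F (next i))
    injConn  : ∀ i j → q i ≡ q j → i ≡ j
    connL    : ∀ i → ConnIn (q i) (F i)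
    connR    : ∀ i → ConnIn (q i) (F (next i))

record Cycle {n k : ℕ} (H : Hypergraph n k) (ℋ : HG n → Set) : Set where
  field
    len     : ℕ
    copies  : Fin len → HG n
    conns   : Fin len → Conn n
    isCycle : IsCycle H ℋ len copies conns
open Cycle public

-- index i pure iff q_{i-1}, q_i are of the same kind; weight 2 if pure,
-- 1 if mixed; so twiceOrder = 2·#pure + #mixed = 2·order.
weight : ∀ {n m} → (Fin m → Conn n) → Fin m → ℕ
weight q i with isEdge (q (prev i)) ≟B isEdge (q i)
... | yes _ = 2
... | no  _ = 1

twiceOrder : ∀ {n k} {H : Hypergraph n k} {ℋ : HG n → Set} → Cycle H ℋ → ℕ
twiceOrder C = sum (map (weight (conns C)) (allFin (len C)))

_≤lex_ : ℕ × ℕ → ℕ × ℕ → Set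
(a , b) ≤lex (c , d) = (a < c) ⊎ ((a ≡ c) × (b ≤ d))

-- h(C) with the order component doubled (order = twiceOrder/2; comparing
-- (2·order, length) lexicographically is the same as comparing (order, length))
h₂ : ∀ {n k} {H : Hypergraph n k} {ℋ : HG n → Set} → Cycle H ℋ → ℕ × ℕ
h₂ C = twiceOrder C , len C

Tidy : ∀ {n k} {H : Hypergraph n k} {ℋ : HG n → Set} → Cycle H ℋ → Set
Tidy {n} {k} {H} C =
  (∀ i j (v : Fin n) (f : Subset n) →
     conns C i ≡ inj₁ v → conns C j ≡ inj₂ f → ¬ (v ∈ f))
  ×
  (∀ (f : Subset n) → f ∈E E H →
     Σ (Fin (len C)) λ i⋆ → ∀ i (v : Fin n) → conns C i ≡ inj₁ v → v ∈ f →
       (i ≡ i⋆) ⊎ (i ≡ next i⋆))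

IsMasterAt : ∀ {n k} {H : Hypergraph n k} {ℋ : HG n → Set} →
             (C : Cycle H ℋ) → Fin (len C) → Set
IsMasterAt {n} {k} {H} {ℋ} C j =
  Σ (Fin (len C) → HG n) λ G →
    (∀ i → ((copies C i ≈H copies C j) × (G i ≡ copies C i))
         ⊎ ((¬ (copies C i ≈H copies C j)) ×
            Σ (Subset n) (λ f → (f ∈E Es (copies C j)) × (G i ≡ plus f))))
    × IsCycle H ℋ (len C) G (conns C)

HasMaster : ∀ {n k} {H : Hypergraph n k} {ℋ : HG n → Set} → Cycle H ℋ → Set
HasMaster C = Σ (Fin (len C)) (IsMasterAt C)

-- Girth(H, ℋ⁺) > (g, ℓ), with g given doubled (g₂ = 2g)
GirthGt₂ : ∀ {n k} (H : Hypergraph n k) (ℋ : HG n → Set) → ℕ × ℕ → Set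
GirthGt₂ H ℋ gl = ∀ (D : Cycle H ℋ) → Tidy D → h₂ D ≤lex gl → HasMaster D

{-# OPTIONS --safe #-}
module Submission where

-- Apply the girth hypothesis to C itself to get a master copy F⋆.  If some
-- connector q_i were an edge e, neither neighbour F_i, F_{i+1} can have been
-- replaced by a trivial copy f⁺: f⁺ would contain e, so f = e, and the other
-- connector of e⁺ would be either the edge e again (against injectivity of the
-- connectors) or a vertex of e (against (T1)).  So F_i ≈ F⋆ ≈ F_{i+1},
-- contradicting that consecutive copies are distinct.  Only (T1) and the
-- girth condition at h(C) itself are used.

open import Defs
open import Data.Nat using (ℕ; zero; suc; _+_; _≤_; s≤s; _%_)
open import Data.Nat.Properties using (≤-refl; +-suc; suc-injective; 1+n≢n; 0≢1+n; m≤n⇒m<n∨m≡n)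
open import Data.Nat.DivMod
  using (n%n≡0; m%n%n≡m%n; [m+n]%n≡m%n; m<n⇒m%n≡m; %-distribˡ-+)
open import Data.Fin using (Fin; toℕ)
open import Data.Fin.Properties using (toℕ-injective; toℕ-fromℕ<; toℕ<n)
open import Data.Fin.Subset using (Subset; _∈_)
open import Data.Product using (_,_; proj₁; proj₂)
open import Data.Sum using (inj₁; inj₂)
open import Data.Empty using (⊥-elim)
open import Relation.Nullary using (¬_; yes; no)
open import Relation.Binary.PropositionalEquality

toℕ-next : ∀ {m} (i : Fin (suc m)) → toℕ (next i) ≡ suc (toℕ i) % suc m
toℕ-next i = toℕ-fromℕ< _

toℕ-prev : ∀ {m} (i : Fin (suc m)) → toℕ (prev i) ≡ (toℕ i + m) % suc m
toℕ-prev i = toℕ-fromℕ< _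

[1+m%n]%n≡[1+m]%n : ∀ m n → suc (m % suc n) % suc n ≡ suc m % suc n
[1+m%n]%n≡[1+m]%n m n = begin
  (1 + m % d) % d           ≡⟨ %-distribˡ-+ 1 (m % d) d ⟩
  (1 % d + m % d % d) % d   ≡⟨ cong (λ x → (1 % d + x) % d) (m%n%n≡m%n m d) ⟩
  (1 % d + m % d) % d       ≡⟨ %-distribˡ-+ 1 m d ⟨
  (1 + m) % d               ∎
  where open ≡-Reasoning; d = suc n

next-prev : ∀ {m} (i : Fin m) → next (prev i) ≡ i
next-prev {suc m} i = toℕ-injective (begin
  toℕ (next (prev i))    ≡⟨ toℕ-next (prev i) ⟩
  suc (toℕ (prev i)) % d ≡⟨ cong (λ x → suc x % d) (toℕ-prev i) ⟩
  suc ((t + m) % d) % d  ≡⟨ [1+m%n]%n≡[1+m]%n (t + m) m ⟩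
  suc (t + m) % d        ≡⟨ cong (_% d) (+-suc t m) ⟨
  (t + d) % d            ≡⟨ [m+n]%n≡m%n t d ⟩
  t % d                  ≡⟨ m<n⇒m%n≡m (toℕ<n i) ⟩
  t                      ∎)
  where open ≡-Reasoning; t = toℕ i; d = suc m

next-≢ : ∀ {m} → 2 ≤ m → (i : Fin m) → next i ≢ i
next-≢ {suc zero} (s≤s ()) i
next-≢ {suc (suc m)} _ i next≡i with m≤n⇒m<n∨m≡n (toℕ<n i)
... | inj₁ 1+i<d = 1+n≢n (begin
  suc (toℕ i)      ≡⟨ m<n⇒m%n≡m 1+i<d ⟨
  suc (toℕ i) % d  ≡⟨ toℕ-next i ⟨
  toℕ (next i)     ≡⟨ cong toℕ next≡i ⟩
  toℕ i            ∎)
  where open ≡-Reasoning; d = suc (suc m)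
... | inj₂ 1+i≡d = 0≢1+n (begin
  0                ≡⟨ n%n≡0 d ⟨
  d % d            ≡⟨ cong (_% d) 1+i≡d ⟨
  suc (toℕ i) % d  ≡⟨ toℕ-next i ⟨
  toℕ (next i)     ≡⟨ cong toℕ next≡i ⟩
  toℕ i            ≡⟨ suc-injective 1+i≡d ⟩
  suc m            ∎)
  where open ≡-Reasoning; d = suc (suc m)

prev-≢ : ∀ {m} → 2 ≤ m → (i : Fin m) → prev i ≢ i
prev-≢ 2≤m i prev≡i = next-≢ 2≤m i (trans (cong next (sym prev≡i)) (next-prev i))

≈H-sym : ∀ {n} {F G : HG n} → F ≈H G → G ≈H F
≈H-sym (V≡ , Es≡) = sym V≡ , λ e → sym (Es≡ e)

≈H-trans : ∀ {n} {F G K : HG n} → F ≈H G → G ≈H K → F ≈H K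
≈H-trans (V≡ , Es≡) (V≡′ , Es≡′) = trans V≡ V≡′ , λ e → trans (Es≡ e) (Es≡′ e)

∈E-plus⇒≡ : ∀ {n} {e f : Subset n} → e ∈E Es (plus f) → e ≡ f
∈E-plus⇒≡ {e = e} {f} e∈f⁺ with e ≟S f | e∈f⁺
... | yes e≡f | _ = e≡f
... | no _    | ()

NoVertexInEdgeConnector : ∀ {n m} → (Fin m → Conn n) → Set
NoVertexInEdgeConnector {n} q =
  ∀ i j (v : Fin n) (f : Subset n) → q i ≡ inj₁ v → q j ≡ inj₂ f → ¬ (v ∈ f)

module EdgeConnector
  {n k m} {H : Hypergraph n k} {ℋ : HG n → Set}
  {G : Fin m → HG n} {q : Fin m → Conn n} (cyc : IsCycle H ℋ m G q)
  (noVertexIn : NoVertexInEdgeConnector q)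
  {i : Fin m} {e : Subset n} (qᵢ≡e : q i ≡ inj₂ e)
  where

  open IsCycle cyc

  other-connector-∉-plus : ∀ p → p ≢ i → ¬ ConnIn (q p) (plus e)
  other-connector-∉-plus p p≢i with q p in qₚ≡
  ... | inj₁ v = noVertexIn p i v e qₚ≡ qᵢ≡e
  ... | inj₂ f = λ f∈e⁺ →
    p≢i (injConn p i (trans qₚ≡ (trans (cong inj₂ (∈E-plus⇒≡ f∈e⁺)) (sym qᵢ≡e))))

  plus-copy-at-edge : ∀ {F} f → ConnIn (q i) F → F ≡ plus f → F ≡ plus e
  plus-copy-at-edge f qᵢ∈F F≡f⁺ =
    trans F≡f⁺ (cong plus (sym (∈E-plus⇒≡ (subst₂ ConnIn qᵢ≡e F≡f⁺ qᵢ∈F))))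

  left-copy-≢-plus : ∀ f → G i ≢ plus f
  left-copy-≢-plus f Gᵢ≡f⁺ =
    other-connector-∉-plus (prev i) (prev-≢ len≥2 i)
      (subst (ConnIn (q (prev i))) Gₙₚ≡e⁺ (connR (prev i)))
    where
      Gₙₚ≡e⁺ : G (next (prev i)) ≡ plus e
      Gₙₚ≡e⁺ = trans (cong G (next-prev i)) (plus-copy-at-edge f (connL i) Gᵢ≡f⁺)

  right-copy-≢-plus : ∀ f → G (next i) ≢ plus f
  right-copy-≢-plus f Gₙ≡f⁺ =
    other-connector-∉-plus (next i) (next-≢ len≥2 i)
      (subst (ConnIn (q (next i))) (plus-copy-at-edge f (connR i) Gₙ≡f⁺) (connL (next i)))

unreplaced-≈H-master : ∀ {n k} {H : Hypergraph n k} {ℋ : HG n → Set}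
  {C : Cycle H ℋ} {j} (M : IsMasterAt C j) x →
  (∀ f → proj₁ M x ≢ plus f) → copies C x ≈H copies C j
unreplaced-≈H-master (_ , replaced , _) x notPlus with replaced x
... | inj₁ (Cₓ≈Cⱼ , _)          = Cₓ≈Cⱼ
... | inj₂ (_ , f , _ , Gₓ≡f⁺) = ⊥-elim (notPlus f Gₓ≡f⁺)

lemma4p15 : ∀ {n k : ℕ} (H : Hypergraph n k) (ℋ : HG n → Set) →
    Linear H →
    (∀ F → ℋ F → IsSub H F) →
    (C : Cycle H ℋ) → Tidy C → GirthGt₂ H ℋ (h₂ C) →
    ∀ i → IsVertex (conns C i)
lemma4p15 H ℋ _ _ C tidy girth i with conns C i in qᵢ≡ | girth C tidy (inj₂ (refl , ≤-refl))
... | inj₁ v | _ = v , refl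
... | inj₂ e | j , M = ⊥-elim (IsCycle.distinct (isCycle C) i
      (≈H-trans (kept i left-copy-≢-plus) (≈H-sym (kept (next i) right-copy-≢-plus))))
  where
    kept : ∀ x → (∀ f → proj₁ M x ≢ plus f) → copies C x ≈H copies C j
    kept = unreplaced-≈H-master {C = C} M
    open EdgeConnector (proj₂ (proj₂ M)) (proj₁ tidy) qᵢ≡
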